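{- For any tree $T$ and rotor configuration $r$, the total number of escapes $E_\infty(T,r):=\lim_{n\to\infty}E_n(T,r)\in\{0,1,2,\dots\}\cup\{\infty\}$ equals the number of live ends of $T$ for the initial configuration $r$.
   Context: A tree $T$ is an infinite tree with all vertex degrees finite and a distinguished root $\rho$ of degree $1$; $V_\rho$ is its set of non-root vertices. For $v\in V_\rho$, $v^{(0)}$ is the parent and $v^{(1)},\dots,v^{(b(v))}$ the children of $v$, labelled so that the fixed cyclic order of neighbours of $v$ is $v^{(0)},v^{(1)},\dots,v^{(b(v))}$. A rotor configuration is a map $r$ on $V_\rho$ with $0\le r(v)\le b(v)$, meaning the rotor at $v$ points to $v^{(r(v))}$; the rotor at $\rho$ always points to its only child. Rotor walk: at each step the rotor at the particle's current vertex is advanced to the next neighbour in the cyclic order, and the particle moves there. Particles are started one after another at $\rho$: each performs rotor walk until it first returns to $\rho$, or else never returns (it escapes to infinity); the next particle starts with the rotors left by the previous ones. $E_n(T,r)$ is the number of the first $n$ particles that escape. A live path is an infinite sequence of vertices $x_1,x_2,\dots$ with $x_1\ne\rho$, each the parent of the next, such that for each $i$ the index $k$ with $x_{i+1}=x_i^{(k)}$ satisfies $r(x_i)<k$. An end of $T$ is an infinite sequence $\rho=x_0,x_1,\dots$ of vertices, each the parent of the next; an end is live if for some $j$ the tail $(x_i)_{i\ge j}$ is a live path. -}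

module Defs where

open import Data.Nat using (ℕ; zero; suc; _≤_; _<_; _≟_)
open import Data.Bool using (Bool; true; false)
open import Data.List using (List; []; _∷_)
open import Data.List.Properties using (≡-dec)
open import Data.List.Membership.Propositional using (_∈_)
open import Data.Maybe using (Maybe; just; nothing)
open import Data.Product using (Σ; _×_; _,_; ∃; proj₁; proj₂)
open import Data.Sum using (_⊎_)
open import Data.Fin using (Fin)
open import Data.Unit using (⊤)
open import Relation.Nullary using (¬_; yes; no)
open import Relation.Binary.PropositionalEquality using (_≡_; _≢_)

-- A non-root vertex is addressed by the list of child indices leading to it
-- from the unique child of the root, MOST RECENT INDEX FIRST:
--   []       is the unique child of the root ρ,
--   k ∷ v    is the k-th child v^(k) of v  (1 ≤ k ≤ b v).
-- A tree is given by its branching function b (number of children);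
-- b is only relevant on valid addresses.

Vertex : Set
Vertex = List ℕ

record Tree : Set where
  field
    b : Vertex → ℕ

open Tree public

Valid : Tree → Vertex → Set
Valid T []      = ⊤
Valid T (k ∷ v) = Valid T v × (1 ≤ k) × (k ≤ b T v)

Infinite : Tree → Set
Infinite T = (l : List Vertex) → Σ Vertex (λ v → Valid T v × ¬ (v ∈ l))

-- Rotor configurations: r v ∈ {0,…,b v}; r v = 0 means pointing to the
-- parent v^(0), r v = k ≥ 1 means pointing to the child k ∷ v.
-- (The rotor at ρ always points to its unique child and is not stored.)

Config : Set
Config = Vertex → ℕ

IsRotorConfig : Tree → Config → Set
IsRotorConfig T r = (v : Vertex) → Valid T v → r v ≤ b T v

-- position of the particle: nothing = ρ, just v = the vertex v
Pos : Set
Pos = Maybe Vertex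

record State : Set where
  constructor st
  field
    pos : Pos
    cfg : Config

open State public

advance : Tree → Vertex → ℕ → ℕ
advance T v i with i ≟ b T v
... | yes _ = 0
... | no  _ = suc i

update : Config → Vertex → ℕ → Config
update c v i w with ≡-dec _≟_ w v
... | yes _ = i
... | no  _ = c w

parent : Vertex → Pos
parent []      = nothing
parent (_ ∷ v) = just v

nbr : Vertex → ℕ → Pos
nbr v zero    = parent v
nbr v (suc k) = just (suc k ∷ v)

step : Tree → State → State
step T (st nothing c)  = st (just []) c
step T (st (just v) c) =
  let i = advance T v (c v) in st (nbr v i) (update c v i)

walk : Tree → Config → ℕ → State
walk T c zero    = st nothing c
walk T c (suc t) = step T (walk T c t)

ReturnsWith : Tree → Config → Config → Set
ReturnsWith T c c' = Σ ℕ λ t →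
    (1 ≤ t)
  × (pos (walk T c t) ≡ nothing)
  × ((s : ℕ) → 1 ≤ s → s < t → pos (walk T c s) ≢ nothing)
  × ((v : Vertex) → cfg (walk T c t) v ≡ c' v)

Escapes : Tree → Config → Set
Escapes T c = (t : ℕ) → 1 ≤ t → pos (walk T c t) ≢ nothing

-- the rotors left behind by a particle running forever: the pointwise
-- eventual values of the rotors along the infinite walk
LimitConfig : Tree → Config → Config → Set
LimitConfig T c c' = (v : Vertex) → Σ ℕ λ t₀ →
  (t : ℕ) → t₀ ≤ t → cfg (walk T c t) v ≡ c' v

-- A run of the whole process: cs k is the configuration seen by
-- particle k (k = 0,1,2,…), esc k says whether particle k escaped.
Process : Tree → Config → (ℕ → Config) → (ℕ → Bool) → Set
Process T r cs esc =
    ((v : Vertex) → cs 0 v ≡ r v)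
  × ((k : ℕ) →
        ((esc k ≡ false) × ReturnsWith T (cs k) (cs (suc k)))
      ⊎ ((esc k ≡ true) × Escapes T (cs k) × LimitConfig T (cs k) (cs (suc k))))

count : (ℕ → Bool) → ℕ → ℕ
count esc zero = 0
count esc (suc n) with esc n
... | true  = suc (count esc n)
... | false = count esc n

-- Ends.  An end ρ = x₀, x₁, x₂, … is coded by e : ℕ → ℕ with
-- x₁ = [] and x_{i+2} = x_{i+1}^(e i); the address of x_{i+1} is prefix e i.

prefix : (ℕ → ℕ) → ℕ → Vertex
prefix e zero    = []
prefix e (suc i) = e i ∷ prefix e i

IsEnd : Tree → (ℕ → ℕ) → Set
IsEnd T e = (i : ℕ) → (1 ≤ e i) × (e i ≤ b T (prefix e i))

-- live: some tail (x_i)_{i ≥ m+1} is a live path, i.e. r(x_{i+1}) < e i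
-- for all i ≥ m
IsLiveEnd : Tree → Config → (ℕ → ℕ) → Set
IsLiveEnd T r e = IsEnd T e × Σ ℕ λ m → (i : ℕ) → m ≤ i → r (prefix e i) < e i

SameEnd : (ℕ → ℕ) → (ℕ → ℕ) → Set
SameEnd e e' = (i : ℕ) → e i ≡ e' i

AtLeastLiveEnds : Tree → Config → ℕ → Set
AtLeastLiveEnds T r k = Σ (Fin k → (ℕ → ℕ)) λ f →
    ((a : Fin k) → IsLiveEnd T r (f a))
  × ((a a' : Fin k) → a ≢ a' → ¬ SameEnd (f a) (f a'))

AtLeastEscapes : (ℕ → Bool) → ℕ → Set
AtLeastEscapes esc k = Σ ℕ λ n → k ≤ count esc n

-- An escaping particle settles into a single end, vertex by vertex: below a vertex it
-- eventually never leaves, the rotor there only moves forward, so it stops at the child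
-- the particle finally enters.  That end was live before the particle passed (each of
-- these rotors started strictly before the child) and is dead afterwards, while along
-- every other end the rotors are eventually untouched; a returning particle changes no
-- rotor deeper than its return time.  So each escape kills exactly one live end and
-- leaves the others live.  Conversely a live end cannot survive a run of returning
-- particles: particle j reaches depth j of it (the previous particle left the rotor
-- there at 0, so the next one passes on to the live child), and a particle reaching
-- the live tail is trapped below it and never returns.
module Submission where

open import Defs
open import Level using (0ℓ)
open import Axiom.ExcludedMiddle using (ExcludedMiddle)
open import Data.Nat using (ℕ; zero; suc; _+_; _≤_; _<_; z≤n; s≤s; _⊔_; _≟_; _≤?_; _<?_)
open import Data.Nat.Properties
open import Data.Bool using (Bool; true; false)
open import Data.List using ([]; _∷_; length)
open import Data.List.Properties using (≡-dec; ∷-injectiveˡ)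
open import Data.Maybe using (just; nothing)
import Data.Maybe.Properties as Maybe
open import Data.Product using (Σ; _×_; _,_; proj₁; proj₂)
open import Data.Sum using (_⊎_; inj₁; inj₂; [_,_]′)
open import Data.Fin as Fin using (Fin; punchIn; inject≤)
open import Data.Fin.Properties using (punchIn-injective; punchInᵢ≢i; inject≤-injective)
open import Data.Empty using (⊥)
open import Data.Unit using (tt)
open import Function using (_∘_)
open import Relation.Nullary using (¬_; Dec; yes; no; ¬?; contradiction)
open import Relation.Nullary.Decidable using (decidable-stable; _×-dec_)
open import Relation.Unary using (Pred; Decidable)
open import Relation.Binary using (tri<; tri≈; tri>)
open import Relation.Binary.PropositionalEquality
open import Function.Bundles using (_⇔_; mk⇔)

-- Searching and stabilising in ℕ

induction-from : ∀ {p} {Q : ℕ → Set p} {a} → Q a → (∀ {u} → a ≤ u → Q u → Q (suc u)) →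
  ∀ {u} → a ≤ u → Q u
induction-from qa step {u} a≤u with m≤n⇒m<n∨m≡n a≤u
... | inj₂ refl = qa
induction-from qa step {zero}  _ | inj₁ ()
induction-from qa step {suc u} _ | inj₁ a<1+u =
  step (≤-pred a<1+u) (induction-from qa step (≤-pred a<1+u))

module _ {p} {Q : Pred ℕ p} (Q? : Decidable Q) where

  private
    least-below : ∀ n → (Σ ℕ λ u → u < n × Q u × (∀ {v} → v < u → ¬ Q v)) ⊎ (∀ {v} → v < n → ¬ Q v)
    least-below zero = inj₂ λ ()
    least-below (suc n) with least-below n
    ... | inj₁ (u , u<n , q , before) = inj₁ (u , m≤n⇒m≤1+n u<n , q , before)
    ... | inj₂ none with Q? n
    ...   | yes q = inj₁ (n , ≤-refl , q , none)
    ...   | no ¬q = inj₂ λ v<1+n → [ none , (λ { refl → ¬q }) ]′ (m≤n⇒m<n∨m≡n (≤-pred v<1+n))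

  least-witness : ∀ {b} → Q b → Σ ℕ λ u → u ≤ b × Q u × (∀ {v} → v < u → ¬ Q v)
  least-witness {b} qb with least-below (suc b)
  ... | inj₁ (u , u<1+b , q , before) = u , ≤-pred u<1+b , q , before
  ... | inj₂ none = contradiction qb (none ≤-refl)

  last-crossing : ∀ {a b} → a ≤ b → Q a → ¬ Q b →
    Σ ℕ λ u → a ≤ u × u < b × Q u × (∀ {v} → u < v → v ≤ b → ¬ Q v)
  last-crossing {b = zero} z≤n qa ¬qb = contradiction qa ¬qb
  last-crossing {a} {suc b} a≤ qa ¬qb with m≤n⇒m<n∨m≡n a≤
  ... | inj₂ refl = contradiction qa ¬qb
  ... | inj₁ a<1+b with Q? b
  ...   | yes qb = b , ≤-pred a<1+b , ≤-refl , qb ,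
                   λ b<v v≤1+b → subst (¬_ ∘ Q) (sym (≤-antisym v≤1+b b<v)) ¬qb
  ...   | no ¬qb′ with last-crossing (≤-pred a<1+b) qa ¬qb′
  ...     | u , a≤u , u<b , qu , after = u , a≤u , m≤n⇒m≤1+n u<b , qu , after′
    where
    after′ : ∀ {v} → u < v → v ≤ suc b → ¬ Q v
    after′ u<v v≤1+b with m≤n⇒m<n∨m≡n v≤1+b
    ... | inj₁ v<1+b = after u<v (≤-pred v<1+b)
    ... | inj₂ refl  = ¬qb

monotone-bounded-stabilises : ExcludedMiddle 0ℓ → (f : ℕ → ℕ) {B : ℕ} →
  (∀ {a b} → a ≤ b → f a ≤ f b) → (∀ u → f u ≤ B) →
  ∀ t₀ → Σ ℕ λ t₁ → t₀ ≤ t₁ × (∀ {u} → t₁ ≤ u → f u ≡ f t₁)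
monotone-bounded-stabilises em f {B} mono bound t₀ = go B t₀ (m≤n+m B (f t₀))
  where
  go : ∀ slack t₀ → B ≤ f t₀ + slack → Σ ℕ λ t₁ → t₀ ≤ t₁ × (∀ {u} → t₁ ≤ u → f u ≡ f t₁)
  go zero t₀ B≤ = t₀ , ≤-refl , λ t₀≤u →
    ≤-antisym (≤-trans (bound _) (subst (B ≤_) (+-identityʳ _) B≤)) (mono t₀≤u)
  go (suc slack) t₀ B≤ with em {Σ ℕ λ u → t₀ ≤ u × f t₀ < f u}
  ... | no stuck = t₀ , ≤-refl , λ {u} t₀≤u →
    ≤-antisym (≮⇒≥ λ grows → stuck (u , t₀≤u , grows)) (mono t₀≤u)
  ... | yes (u , t₀≤u , grows) with go slack u
        (≤-trans B≤ (≤-trans (≤-reflexive (+-suc (f t₀) slack)) (+-monoˡ-≤ slack grows)))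
  ...   | t₁ , u≤t₁ , stable = t₁ , ≤-trans t₀≤u u≤t₁ , stable

count-step : ∀ esc n → count esc n ≤ count esc (suc n)
count-step esc n with esc n
... | true  = n≤1+n _
... | false = ≤-refl

count-mono : ∀ esc {a b} → a ≤ b → count esc a ≤ count esc b
count-mono esc {a} = induction-from {Q = λ b → count esc a ≤ count esc b} ≤-refl
  (λ _ a≤ → ≤-trans a≤ (count-step esc _))

count-true : ∀ esc {q} → esc q ≡ true → count esc (suc q) ≡ suc (count esc q)
count-true esc {q} escaped with esc q
count-true esc refl | true = refl

-- Vertices, ends and positions

data _≼_ (x : Vertex) : Vertex → Set where
  here  : x ≼ x
  there : ∀ {k w} → x ≼ w → x ≼ (k ∷ w)

≼-length : ∀ {x w} → x ≼ w → length x ≤ length w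
≼-length here      = ≤-refl
≼-length (there p) = m≤n⇒m≤1+n (≼-length p)

≼-trans : ∀ {x y z} → x ≼ y → y ≼ z → x ≼ z
≼-trans p here      = p
≼-trans p (there q) = there (≼-trans p q)

longer⇒≢ : ∀ {v w : Vertex} → length v < length w → v ≢ w
longer⇒≢ shorter refl = n≮n _ shorter

∷⋠ : ∀ {k x} → ¬ (k ∷ x) ≼ x
∷⋠ p = 1+n≰n (≼-length p)

[]≼ : ∀ w → [] ≼ w
[]≼ []      = here
[]≼ (_ ∷ w) = there ([]≼ w)

≼[]⇒≡[] : ∀ {x} → x ≼ [] → x ≡ []
≼[]⇒≡[] here = refl

≼∷⇒≡⊎≼ : ∀ {x k w} → x ≼ (k ∷ w) → x ≡ k ∷ w ⊎ x ≼ w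
≼∷⇒≡⊎≼ here      = inj₁ refl
≼∷⇒≡⊎≼ (there p) = inj₂ p

≼⇒≡⊎∷≼ : ∀ {x w} → x ≼ w → x ≡ w ⊎ Σ ℕ λ k → (k ∷ x) ≼ w
≼⇒≡⊎∷≼ here = inj₁ refl
≼⇒≡⊎∷≼ (there {k} p) with ≼⇒≡⊎∷≼ p
... | inj₁ refl    = inj₂ (k , here)
... | inj₂ (j , q) = inj₂ (j , there q)

_≼?_ : ∀ x w → Dec (x ≼ w)
x ≼? [] with ≡-dec _≟_ x []
... | yes refl = yes here
... | no  x≢[] = no (x≢[] ∘ ≼[]⇒≡[])
x ≼? (k ∷ w) with ≡-dec _≟_ x (k ∷ w) | x ≼? w
... | yes refl | _     = yes here
... | no _     | yes p = yes (there p)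
... | no x≢    | no ¬p = no ([ x≢ , ¬p ]′ ∘ ≼∷⇒≡⊎≼)

≼-valid : ∀ {T x w} → x ≼ w → Valid T w → Valid T x
≼-valid here      valid = valid
≼-valid (there p) valid = ≼-valid p (proj₁ valid)

length-prefix : ∀ e i → length (prefix e i) ≡ i
length-prefix e zero    = refl
length-prefix e (suc i) = cong suc (length-prefix e i)

≼-prefix : ∀ e {x} i → x ≼ prefix e i → x ≡ prefix e (length x)
≼-prefix e zero    here      = refl
≼-prefix e (suc i) here      = cong (prefix e) (sym (length-prefix e (suc i)))
≼-prefix e (suc i) (there p) = ≼-prefix e i p

≼-prefix-head : ∀ e e′ {j i} → prefix e′ (suc j) ≼ prefix e i → e′ j ≡ e j
≼-prefix-head e e′ {j} {i} p =
  trans (∷-injectiveˡ (≼-prefix e i p)) (cong e (length-prefix e′ j))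

prefix-cong : ∀ {e e′} → SameEnd e e′ → ∀ i → prefix e i ≡ prefix e′ i
prefix-cong same zero    = refl
prefix-cong same (suc i) = cong₂ _∷_ (same i) (prefix-cong same i)

LiveFrom : Config → (ℕ → ℕ) → ℕ → Set
LiveFrom c e m = ∀ i → m ≤ i → c (prefix e i) < e i

LiveFrom-mono : ∀ {c e m i} → m ≤ i → LiveFrom c e m → LiveFrom c e i
LiveFrom-mono m≤i live i′ i≤i′ = live i′ (≤-trans m≤i i≤i′)

_≟ₚ_ : (p q : Pos) → Dec (p ≡ q)
_≟ₚ_ = Maybe.≡-dec (≡-dec _≟_)

InSubtree : Vertex → Pos → Set
InSubtree x nothing  = ⊥
InSubtree x (just w) = x ≼ w

InSubtree? : ∀ x p → Dec (InSubtree x p)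
InSubtree? x nothing  = no λ ()
InSubtree? x (just w) = x ≼? w

≡just⇒InSubtree : ∀ {p v} → p ≡ just v → InSubtree v p
≡just⇒InSubtree refl = here

InSubtree-anti : ∀ {x y} p → x ≼ y → InSubtree y p → InSubtree x p
InSubtree-anti (just w) x≼y y≼w = ≼-trans x≼y y≼w

InSubtree-strict : ∀ {x} p → InSubtree x p → p ≢ just x → Σ ℕ λ k → InSubtree (k ∷ x) p
InSubtree-strict (just w) x≼w p≢ with ≼⇒≡⊎∷≼ x≼w
... | inj₁ refl  = contradiction refl p≢
... | inj₂ below = below

InSubtree-valid : ∀ {T x} p → (∀ {v} → p ≡ just v → Valid T v) → InSubtree x p → Valid T x
InSubtree-valid (just w) valid x≼w = ≼-valid x≼w (valid refl)

-- One step of rotor walk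

update-same : ∀ c v i → update c v i v ≡ i
update-same c v i with ≡-dec _≟_ v v
... | yes _  = refl
... | no v≢v = contradiction refl v≢v

update-other : ∀ c v i {w} → w ≢ v → update c v i w ≡ c w
update-other c v i {w} w≢v with ≡-dec _≟_ w v
... | yes w≡v = contradiction w≡v w≢v
... | no _    = refl

advance-cases : ∀ T v i → advance T v i ≡ 0 ⊎ advance T v i ≡ suc i
advance-cases T v i with i ≟ b T v
... | yes _ = inj₁ refl
... | no  _ = inj₂ refl

advance-≤ : ∀ T v {i} → i ≤ b T v → advance T v i ≤ b T v
advance-≤ T v {i} i≤b with i ≟ b T v
... | yes _   = z≤n
... | no  i≢b = ≤∧≢⇒< i≤b i≢b

advance-< : ∀ T v {i} → i < b T v → advance T v i ≡ suc i
advance-< T v {i} i<b with i ≟ b T v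
... | yes refl = contradiction i<b (n≮n i)
... | no  _    = refl

advance-fixed⇒≡0 : ∀ T v {i} → advance T v i ≡ i → advance T v i ≡ 0
advance-fixed⇒≡0 T v {i} fixed with advance-cases T v i
... | inj₁ wraps = wraps
... | inj₂ steps = contradiction (trans (sym fixed) steps) (λ i≡1+i → n≮n i (≤-reflexive (sym i≡1+i)))

nbr-child⇒≡ : ∀ v i {k} → nbr v i ≡ just (k ∷ v) → i ≡ k
nbr-child⇒≡ []      zero    ()
nbr-child⇒≡ (j ∷ v) zero    up   = contradiction (Maybe.just-injective up) (longer⇒≢ (m<n⇒m<1+n (n<1+n _)))
nbr-child⇒≡ v       (suc i) refl = refl

parent≢child : ∀ v {k} → parent v ≢ just (k ∷ v)
parent≢child []      ()
parent≢child (j ∷ v) up = longer⇒≢ (m<n⇒m<1+n (n<1+n _)) (Maybe.just-injective up)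

nbr-parent⇒≡0 : ∀ v i → nbr v i ≡ parent v → i ≡ 0
nbr-parent⇒≡0 v       zero    _    = refl
nbr-parent⇒≡0 []      (suc i) ()
nbr-parent⇒≡0 (j ∷ v) (suc i) down =
  contradiction (sym (Maybe.just-injective down)) (longer⇒≢ (m<n⇒m<1+n (n<1+n _)))

nbr-length : ∀ w i {v} → nbr w i ≡ just v → length v ≤ suc (length w)
nbr-length []      zero    ()
nbr-length (j ∷ w) zero    refl = m≤n⇒m≤1+n (n≤1+n (length w))
nbr-length w       (suc i) refl = ≤-refl

nbr-valid : ∀ {T w} i {v} → Valid T w → i ≤ b T w → nbr w i ≡ just v → Valid T v
nbr-valid {w = []}    zero    _     _   ()
nbr-valid {w = j ∷ w} zero    valid _   refl = proj₁ valid
nbr-valid             (suc i) valid i≤b refl = valid , s≤s z≤n , i≤b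

nbr-leaves : ∀ {x w} i → x ≼ w → ¬ InSubtree x (nbr w i) → w ≡ x × nbr w i ≡ parent x
nbr-leaves (suc i) x≼w out = contradiction (there x≼w) out
nbr-leaves {w = []}    zero x≼w out with ≼[]⇒≡[] x≼w
... | refl = refl , refl
nbr-leaves {w = j ∷ w} zero x≼w out with ≼∷⇒≡⊎≼ x≼w
... | inj₁ refl = refl , refl
... | inj₂ x≼w′ = contradiction x≼w′ out

nbr-enters : ∀ {x w} i → ¬ x ≼ w → InSubtree x (nbr w i) → nbr w i ≡ just x × just w ≡ parent x
nbr-enters (suc i) out x≼ with ≼∷⇒≡⊎≼ x≼
... | inj₁ refl = refl , refl
... | inj₂ x≼w  = contradiction x≼w out
nbr-enters {w = []}    zero out ()
nbr-enters {w = j ∷ w} zero out x≼w = contradiction (there x≼w) out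

step-from : ∀ T {s v} → pos s ≡ just v →
  step T s ≡ st (nbr v (advance T v (cfg s v))) (update (cfg s) v (advance T v (cfg s v)))
step-from T {st (just v) c} refl = refl

step-root : ∀ T {s} → pos s ≡ nothing → step T s ≡ st (just []) (cfg s)
step-root T {st nothing c} refl = refl

module Walk (T : Tree) (c : Config) where

  P : ℕ → Pos
  P t = pos (walk T c t)

  C : ℕ → Config
  C t = cfg (walk T c t)

  P-suc-root : ∀ t → P t ≡ nothing → P (suc t) ≡ just []
  P-suc-root t root = cong pos (step-root T root)

  C-suc-here : ∀ t {v} → P t ≡ just v → C (suc t) v ≡ advance T v (C t v)
  C-suc-here t {v} at = trans (cong (λ s → cfg s v) (step-from T at)) (update-same (C t) v _)

  P-suc-here : ∀ t {v} → P t ≡ just v → P (suc t) ≡ nbr v (C (suc t) v)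
  P-suc-here t {v} at = trans (cong pos (step-from T at)) (cong (nbr v) (sym (C-suc-here t at)))

  C-suc-away : ∀ t {w} → P t ≢ just w → C (suc t) w ≡ C t w
  C-suc-away t {w} away with P t in eq
  ... | nothing = cong (λ s → cfg s w) (step-root T eq)
  ... | just v  = trans (cong (λ s → cfg s w) (step-from T eq))
                        (update-other (C t) v _ (away ∘ cong just ∘ sym))

  came-from : ∀ t {v} → P (suc t) ≡ just v →
    (P t ≡ nothing × v ≡ []) ⊎ Σ Vertex λ w → P t ≡ just w × nbr w (C (suc t) w) ≡ just v
  came-from t moved with P t in eq
  ... | nothing = inj₁ (refl , Maybe.just-injective (trans (sym moved) (P-suc-root t eq)))
  ... | just w  = inj₂ (w , refl , trans (sym (P-suc-here t eq)) moved)

  turns-to-next-child : ∀ u {v} → P u ≡ just v → C u v < b T v →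
    C (suc u) v ≡ suc (C u v) × P (suc u) ≡ just (suc (C u v) ∷ v)
  turns-to-next-child u {v} at below = turned , trans (P-suc-here u at) (cong (nbr v) turned)
    where
    turned : C (suc u) v ≡ suc (C u v)
    turned = trans (C-suc-here u at) (advance-< T v below)

  rotor-unchanged : ∀ w {a b} → a ≤ b → (∀ {u} → a ≤ u → u < b → P u ≢ just w) → C b w ≡ C a w
  rotor-unchanged w {b = zero} z≤n away = refl
  rotor-unchanged w {a} {suc b} a≤ away with m≤n⇒m<n∨m≡n a≤
  ... | inj₂ refl  = refl
  ... | inj₁ a<1+b = trans (C-suc-away b (away (≤-pred a<1+b) ≤-refl))
    (rotor-unchanged w (≤-pred a<1+b) λ a≤u u<b → away a≤u (m≤n⇒m≤1+n u<b))

  depth-< : ∀ t {v} → P t ≡ just v → length v < t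
  depth-< zero ()
  depth-< (suc t) at with came-from t at
  ... | inj₁ (_ , refl)    = s≤s z≤n
  ... | inj₂ (w , pw , nb) = s≤s (≤-trans (nbr-length w (C (suc t) w) nb) (depth-< t pw))

  deep-rotor-unchanged : ∀ t w → t ≤ length w → C t w ≡ c w
  deep-rotor-unchanged t w t≤ = rotor-unchanged w z≤n λ {u} _ u<t at →
    n≮n (length w) (<-≤-trans (depth-< u at) (≤-trans (<⇒≤ u<t) t≤))

  module _ (rc : IsRotorConfig T c) where

    valid-rotors : ∀ t → IsRotorConfig T (C t)
    valid-rotors zero = rc
    valid-rotors (suc t) v valid with P t ≟ₚ just v
    ... | yes at   = subst (_≤ b T v) (sym (C-suc-here t at)) (advance-≤ T v (valid-rotors t v valid))
    ... | no  away = subst (_≤ b T v) (sym (C-suc-away t away)) (valid-rotors t v valid)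

    valid-position : ∀ t {v} → P t ≡ just v → Valid T v
    valid-position zero ()
    valid-position (suc t) at with came-from t at
    ... | inj₁ (_ , refl)    = tt
    ... | inj₂ (w , pw , nb) =
      nbr-valid _ (valid-position t pw) (valid-rotors (suc t) w (valid-position t pw)) nb

  rotor-kept-above : ∀ t {v y k} → P t ≡ just v → (k ∷ y) ≼ v → C (suc t) y ≡ C t y
  rotor-kept-above t {v} {y} {k} pv below =
    C-suc-away t λ at → ∷⋠ (subst ((k ∷ y) ≼_) (Maybe.just-injective (trans (sym pv) at)) below)

  rotor-towards : ∀ t {w} → P t ≡ just w → ∀ {y k} → (k ∷ y) ≼ w → C t y ≡ k
  rotor-towards-after-move : ∀ t {v w} → P t ≡ just v → nbr v (C (suc t) v) ≡ just w →
    ∀ {y k} → (k ∷ y) ≼ w → C (suc t) y ≡ k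

  rotor-towards zero ()
  rotor-towards (suc t) at below with came-from t at
  ... | inj₁ (_ , refl)    = contradiction (≼[]⇒≡[] below) λ ()
  ... | inj₂ (v , pv , nb) = rotor-towards-after-move t pv nb below

  rotor-towards-after-move t {v} pv nb below with C (suc t) v in turned
  rotor-towards-after-move t {[]}    pv () below | zero
  rotor-towards-after-move t {j ∷ v} pv refl below | zero =
    trans (rotor-kept-above t pv (there below)) (rotor-towards t pv (there below))
  rotor-towards-after-move t pv refl below | suc i with ≼∷⇒≡⊎≼ below
  ... | inj₁ refl    = turned
  ... | inj₂ below′  = trans (rotor-kept-above t pv below′) (rotor-towards t pv below′)

  ancestor-rotor : ∀ t {y k} → InSubtree (k ∷ y) (P t) → C t y ≡ k
  ancestor-rotor t inside with P t in at
  ... | just w = rotor-towards t at inside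

  leaves : ∀ t {x} → InSubtree x (P t) → ¬ InSubtree x (P (suc t)) → P t ≡ just x × P (suc t) ≡ parent x
  leaves t {x} inside out with P t in at
  ... | just w with nbr-leaves (C (suc t) w) inside (out ∘ subst (InSubtree x) (sym (P-suc-here t at)))
  ...   | refl , up = refl , trans (P-suc-here t at) up

  enters : ∀ t {x} → ¬ InSubtree x (P t) → InSubtree x (P (suc t)) → P (suc t) ≡ just x × P t ≡ parent x
  enters t {x} out inside with P t in at
  ... | nothing with ≼[]⇒≡[] (subst (InSubtree x) (P-suc-root t at) inside)
  ...   | refl = P-suc-root t at , refl
  enters t {x} out inside | just w
    with nbr-enters (C (suc t) w) out (subst (InSubtree x) (P-suc-here t at) inside)
  ... | down , from = trans (P-suc-here t at) down , from

  last-entry : ∀ x {a b} → a ≤ b → ¬ InSubtree x (P a) → InSubtree x (P b) →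
    Σ ℕ λ u → a ≤ u × u < b × P u ≡ parent x × P (suc u) ≡ just x
  last-entry x a≤b out inside
    with last-crossing (λ t → ¬? (InSubtree? x (P t))) a≤b out (λ out′ → out′ inside)
  ... | u , a≤u , u<b , out-u , later
    with enters u out-u (decidable-stable (InSubtree? x (P (suc u))) (later ≤-refl u<b))
  ...   | down , from = u , a≤u , u<b , from , down

  rotor-zero-after-return : ∀ {s t v} → P s ≡ just v → s ≤ t → P t ≡ nothing → C t v ≡ 0
  rotor-zero-after-return {s} {t} {v} at s≤t returned
    with last-crossing (λ u → InSubtree? v (P u)) s≤t (≡just⇒InSubtree at) (subst (InSubtree v) returned)
  ... | u , _ , u<t , inside , later with leaves u inside (later ≤-refl u<t)
  ...   | pu , up =
    trans (rotor-unchanged v u<t λ u<u′ u′<t at′ → later u<u′ (<⇒≤ u′<t) (≡just⇒InSubtree at′))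
          (nbr-parent⇒≡0 v _ (trans (sym (P-suc-here u pu)) up))

  rotor-wraps-or-grows : ∀ y {a b} → a ≤ b →
    (Σ ℕ λ u → a ≤ u × u < b × P u ≡ just y × C (suc u) y ≡ 0) ⊎ C a y ≤ C b y
  rotor-wraps-or-grows y {b = zero} z≤n = inj₂ ≤-refl
  rotor-wraps-or-grows y {a} {suc b} a≤ with m≤n⇒m<n∨m≡n a≤
  ... | inj₂ refl  = inj₂ ≤-refl
  ... | inj₁ a<1+b with rotor-wraps-or-grows y (≤-pred a<1+b)
  ...   | inj₁ (u , a≤u , u<b , at , wraps) = inj₁ (u , a≤u , m≤n⇒m≤1+n u<b , at , wraps)
  ...   | inj₂ grows with P b ≟ₚ just y
  ...     | no away = inj₂ (subst (C a y ≤_) (sym (C-suc-away b away)) grows)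
  ...     | yes at with advance-cases T y (C b y)
  ...       | inj₁ wraps = inj₁ (b , ≤-pred a<1+b , ≤-refl , at , trans (C-suc-here b at) wraps)
  ...       | inj₂ steps = inj₂ (subst (C a y ≤_) (sym (trans (C-suc-here b at) steps)) (m≤n⇒m≤1+n grows))

  FirstVisit : Vertex → ℕ → Set
  FirstVisit x s = P s ≡ just x × (∀ {u} → u < s → ¬ InSubtree x (P u))

  first-visit : ∀ {x t} → InSubtree x (P t) → Σ ℕ λ s → s ≤ t × FirstVisit x s
  first-visit {x} inside with least-witness (λ u → InSubtree? x (P u)) inside
  ... | zero  , _   , ()   , _
  ... | suc s , s<t , in-s , before = suc s , s<t , proj₁ (enters s (before ≤-refl) in-s) , before

  first-visit-untouched : ∀ {x s} → FirstVisit x s → ∀ {w} → x ≼ w → C s w ≡ c w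
  first-visit-untouched {x} (_ , before) x≼w =
    rotor-unchanged _ z≤n λ _ u<s at → before u<s (subst (InSubtree x) (sym at) x≼w)

  first-visit-child-later : ∀ {x k s j} → FirstVisit x s → FirstVisit (k ∷ x) j → s < j
  first-visit-child-later {x} {k} {s} {j} (at , before) (at′ , _) with <-cmp j s
  ... | tri< j<s _ _ = contradiction (InSubtree-anti (P j) (there here) (≡just⇒InSubtree at′)) (before j<s)
  ... | tri≈ _ refl _ = contradiction (subst (InSubtree (k ∷ x)) at (≡just⇒InSubtree at′)) ∷⋠
  ... | tri> _ _ s<j = s<j

  sweep-step : ∀ u {v k} → k ≤ b T v → InSubtree v (P u) → C u v < k → ¬ InSubtree (k ∷ v) (P (suc u)) →
    InSubtree v (P (suc u)) × C (suc u) v < k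
  sweep-step u {v} {k} k≤b inside below avoid with P u ≟ₚ just v
  ... | no away = remains , subst (_< k) (sym (C-suc-away u away)) below
    where
    remains : InSubtree v (P (suc u))
    remains with InSubtree? v (P (suc u))
    ... | yes inside′ = inside′
    ... | no  out     = contradiction (proj₁ (leaves u inside out)) away
  ... | yes at with turns-to-next-child u at (<-≤-trans below k≤b) | suc (C u v) ≟ k
  ...   | turned , moved | yes refl = contradiction (subst (InSubtree (k ∷ v)) (sym moved) here) avoid
  ...   | turned , moved | no  ¬k   =
    subst (InSubtree v) (sym moved) (there here) , subst (_< k) (sym turned) (≤∧≢⇒< below ¬k)

  -- The rotor at v moves up one child at a time, so it cannot wrap without first sending
  -- the particle into the subtree of k ∷ v.
  sweep : ∀ {s v k} → P s ≡ just v → C s v < k → k ≤ b T v → ∀ {u} → s ≤ u →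
    (∀ {t} → s ≤ t → t ≤ u → ¬ InSubtree (k ∷ v) (P t)) → InSubtree v (P u) × C u v < k
  sweep {s} {v} {k} at below k≤b = induction-from
    {Q = λ u → (∀ {t} → s ≤ t → t ≤ u → ¬ InSubtree (k ∷ v) (P t)) → InSubtree v (P u) × C u v < k}
      (λ _ → ≡just⇒InSubtree at , below)
      λ {u} s≤u ih avoid →
        let inside , below′ = ih (λ s≤t t≤u → avoid s≤t (m≤n⇒m≤1+n t≤u))
        in sweep-step u k≤b inside below′ (avoid (m≤n⇒m≤1+n s≤u) ≤-refl)

  sweep-or-enter : ∀ {s v k} → P s ≡ just v → C s v < k → k ≤ b T v → ∀ {u} → s ≤ u →
    InSubtree v (P u) ⊎ Σ ℕ λ j → j ≤ u × FirstVisit (k ∷ v) j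
  sweep-or-enter {v = v} {k} at below k≤b {u} s≤u with anyUpTo? (λ t → InSubtree? (k ∷ v) (P t)) (suc u)
  ... | yes (t , t<1+u , inside) with first-visit inside
  ...   | j , j≤t , fv = inj₂ (j , ≤-trans j≤t (≤-pred t<1+u) , fv)
  sweep-or-enter at below k≤b s≤u | no never =
    inj₁ (proj₁ (sweep at below k≤b s≤u λ _ t≤u inside → never (_ , s≤s t≤u , inside)))

  visits-child-before-return : ∀ {s t v k} → P s ≡ just v → C s v < k → k ≤ b T v → s ≤ t →
    P t ≡ nothing → Σ ℕ λ j → j < t × P j ≡ just (k ∷ v)
  visits-child-before-return {t = t} at below k≤b s≤t returned with sweep-or-enter at below k≤b s≤t
  ... | inj₁ inside = contradiction (subst (InSubtree _) returned inside) λ ()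
  ... | inj₂ (j , j≤t , at′ , _) =
    j , ≤∧≢⇒< j≤t (λ { refl → contradiction (trans (sym at′) returned) λ () }) , at′

  module _ {e : ℕ → ℕ} (end : IsEnd T e) where

    -- Until it enters the child e m for the first time, sweep keeps the particle below
    -- prefix e m; it enters that child with all rotors below still live, so the argument
    -- repeats there.  The fuel n bounds u ∸ s.
    private
      trapped-within : ∀ n {m} → LiveFrom c e m → ∀ {s} → FirstVisit (prefix e m) s →
        ∀ {u} → s ≤ u → u ≤ s + n → InSubtree (prefix e m) (P u)
      trapped-within n {m} live {s} fv s≤u u≤ with sweep-or-enter (proj₁ fv)
        (subst (_< e m) (sym (first-visit-untouched fv here)) (live m ≤-refl)) (proj₂ (end m)) s≤u
      ... | inj₁ inside = inside
      trapped-within zero {m} live {s} fv s≤u u≤ | inj₂ (j , j≤u , fv′) =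
        contradiction
          (<-≤-trans (first-visit-child-later fv fv′) (≤-trans j≤u (≤-trans u≤ (≤-reflexive (+-identityʳ s)))))
          (n≮n s)
      trapped-within (suc n) {m} live {s} fv {u} s≤u u≤ | inj₂ (j , j≤u , fv′) =
        InSubtree-anti (P u) (there here) (trapped-within n (LiveFrom-mono {c} (n≤1+n m) live) fv′ j≤u bound)
        where
        bound : u ≤ j + n
        bound = ≤-trans u≤ (≤-trans (≤-reflexive (+-suc s n)) (+-monoˡ-≤ n (first-visit-child-later fv fv′)))

    trapped : ∀ {m} → LiveFrom c e m → ∀ {s} → FirstVisit (prefix e m) s →
      ∀ {u} → s ≤ u → InSubtree (prefix e m) (P u)
    trapped live fv {u} s≤u = trapped-within u live fv s≤u (m≤n+m u _)

    live-tail-untouched : ∀ {m} → LiveFrom c e m → ∀ t → P t ≡ nothing →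
      ∀ {i} → m ≤ i → C t (prefix e i) ≡ c (prefix e i)
    live-tail-untouched live t returned {i} m≤i with anyUpTo? (λ u → P u ≟ₚ just (prefix e i)) t
    ... | no never = rotor-unchanged _ z≤n λ {u} _ u<t at → never (u , u<t , at)
    ... | yes (u , u<t , at) with first-visit (≡just⇒InSubtree at)
    ...   | s , s≤u , fv =
      contradiction (subst (InSubtree _) returned (trapped (LiveFrom-mono {c} m≤i live) fv (≤-trans s≤u (<⇒≤ u<t))))
                    λ ()

-- Live ends before and after a particle

module _ (T : Tree) where

  record EventuallyAgree (c c′ : Config) (e : ℕ → ℕ) : Set where
    constructor agree-beyond
    field
      depth : ℕ
      agree : ∀ i → depth ≤ i → c (prefix e i) ≡ c′ (prefix e i)

  EventuallyAgree-sym : ∀ {c c′ e} → EventuallyAgree c c′ e → EventuallyAgree c′ c e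
  EventuallyAgree-sym (agree-beyond M agree) = agree-beyond M λ i M≤i → sym (agree i M≤i)

  live-transfer : ∀ {c c′ e} → EventuallyAgree c c′ e → IsLiveEnd T c e → IsLiveEnd T c′ e
  live-transfer {e = e} (agree-beyond M agree) (end , m , live) = end , m ⊔ M , λ i m⊔M≤i →
    subst (_< e i) (agree i (≤-trans (m≤n⊔m m M) m⊔M≤i)) (live i (≤-trans (m≤m⊔n m M) m⊔M≤i))

  live-SameEnd : ∀ {c e e′} → SameEnd e e′ → IsLiveEnd T c e → IsLiveEnd T c e′
  live-SameEnd {c} same (end , m , live) =
    (λ i → subst₂ (λ k v → 1 ≤ k × k ≤ b T v) (same i) (prefix-cong same i) (end i)) , m ,
    λ i m≤i → subst₂ (λ k v → c v < k) (same i) (prefix-cong same i) (live i m≤i)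

  agree-everywhere : ∀ {c c′ e} → (∀ v → c v ≡ c′ v) → EventuallyAgree c c′ e
  agree-everywhere same = agree-beyond 0 λ i _ → same _

  returned-agree : ∀ {c c′} → ReturnsWith T c c′ → ∀ e → EventuallyAgree c c′ e
  returned-agree {c} (t , _ , _ , _ , final) e = agree-beyond t λ i t≤i →
    trans (sym (Walk.deep-rotor-unchanged T c t (prefix e i) (subst (t ≤_) (sym (length-prefix e i)) t≤i)))
          (final (prefix e i))

  divergence : ExcludedMiddle 0ℓ → ∀ {e e′} → ¬ SameEnd e e′ → Σ ℕ λ j → e j ≢ e′ j
  divergence em {e} {e′} ¬same with em {Σ ℕ λ j → e j ≢ e′ j}
  ... | yes found = found
  ... | no  none  = contradiction (λ j → decidable-stable (e j ≟ e′ j) λ ne → none (j , ne)) ¬same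

  module AllReturn {cs : ℕ → Config} (ret : ∀ j → ReturnsWith T (cs j) (cs (suc j))) where

    module W (j : ℕ) = Walk T (cs j)

    return-time : ℕ → ℕ
    return-time j = proj₁ (ret j)

    returned : ∀ j → W.P j (return-time j) ≡ nothing
    returned j = proj₁ (proj₂ (proj₂ (ret j)))

    after-return : ∀ j v → W.C j (return-time j) v ≡ cs (suc j) v
    after-return j = proj₂ (proj₂ (proj₂ (proj₂ (ret j))))

    VisitsBeforeReturn : ℕ → Vertex → Set
    VisitsBeforeReturn j v = Σ ℕ λ s → s < return-time j × W.P j s ≡ just v

    module _ {e} (end : IsEnd T e) where

      live-tail-persists : ∀ {m} → LiveFrom (cs 0) e m → ∀ j → LiveFrom (cs j) e m
      live-tail-persists live zero = live
      live-tail-persists live (suc j) i m≤i =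
        subst (_< e i) (trans (sym untouched) (after-return j (prefix e i))) (live-tail-persists live j i m≤i)
        where
        untouched : W.C j (return-time j) (prefix e i) ≡ cs j (prefix e i)
        untouched = W.live-tail-untouched j end (live-tail-persists live j) (return-time j) (returned j) m≤i

      -- The previous particle returned through prefix e i, leaving its rotor at 0 < e i,
      -- so the next one passes on to the child e i before returning.
      reaches-depth : ∀ {i j} → i ≤ j → VisitsBeforeReturn j (prefix e i)
      reaches-depth {zero} {j} _ = 1 , ≤∧≢⇒< (proj₁ (proj₂ (ret j))) not-yet , refl
        where
        not-yet : 1 ≢ return-time j
        not-yet 1≡t = contradiction (trans (cong (W.P j) 1≡t) (returned j)) λ ()
      reaches-depth {suc i} {suc j} (s≤s i≤j)
        with reaches-depth {i} {j} i≤j | reaches-depth {i} {suc j} (m≤n⇒m≤1+n i≤j)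
      ... | s , s<t , at | s′ , s′<t′ , at′ with W.first-visit (suc j) (≡just⇒InSubtree at′)
      ...   | s₀ , s₀≤s′ , fv = W.visits-child-before-return (suc j) (proj₁ fv) rotor-below (proj₂ (end i))
                                  (≤-trans s₀≤s′ (<⇒≤ s′<t′)) (returned (suc j))
        where
        rotor-below : W.C (suc j) s₀ (prefix e i) < e i
        rotor-below =
          subst (_< e i) (sym (trans (W.first-visit-untouched (suc j) fv here) left-at-zero)) (proj₁ (end i))
          where
          left-at-zero : cs (suc j) (prefix e i) ≡ 0
          left-at-zero =
            trans (sym (after-return j (prefix e i))) (W.rotor-zero-after-return j at (<⇒≤ s<t) (returned j))

    no-live-end : ∀ {e} → ¬ IsLiveEnd T (cs 0) e
    no-live-end (end , m , live) with reaches-depth end {m} {m} ≤-refl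
    ... | s , s<t , at with W.first-visit m (≡just⇒InSubtree at)
    ...   | s₀ , s₀≤s , fv = subst (InSubtree _) (returned m)
            (W.trapped m end (live-tail-persists end live m) fv (≤-trans s₀≤s (<⇒≤ s<t)))

  record KillsOneEnd (c c′ : Config) : Set where
    field
      killed       : ℕ → ℕ
      killed-live  : IsLiveEnd T c killed
      killed-dead  : ¬ IsLiveEnd T c′ killed
      others-agree : ∀ e → ¬ SameEnd e killed → EventuallyAgree c c′ e

  module _ {c c′} (kill : KillsOneEnd c c′) where
    open KillsOneEnd kill

    live-after-escape : ∀ {e} → IsLiveEnd T c′ e → IsLiveEnd T c e
    live-after-escape {e} live =
      live-transfer (EventuallyAgree-sym (others-agree e λ same → killed-dead (live-SameEnd {c′} same live))) live

    live-before-escape : ∀ {e} → ¬ SameEnd e killed → IsLiveEnd T c e → IsLiveEnd T c′ e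
    live-before-escape {e} other = live-transfer (others-agree e other)

  Distinct : ∀ {k} → (Fin k → ℕ → ℕ) → Set
  Distinct f = ∀ a a′ → a ≢ a′ → ¬ SameEnd (f a) (f a′)

  record LostEnds (r c : Config) (k : ℕ) : Set where
    field
      ends        : Fin k → ℕ → ℕ
      live-before : ∀ a → IsLiveEnd T r (ends a)
      dead-now    : ∀ a → ¬ IsLiveEnd T c (ends a)
      distinct    : Distinct ends

  lost-ends-after-return : ∀ {r c c′ k} → ReturnsWith T c c′ → LostEnds r c k → LostEnds r c′ k
  lost-ends-after-return rw lost = record
    { ends        = ends
    ; live-before = live-before
    ; dead-now    = λ a → dead-now a ∘ live-transfer (EventuallyAgree-sym (returned-agree rw (ends a)))
    ; distinct    = distinct
    }
    where open LostEnds lost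

  lost-ends-after-escape : ∀ {r c c′ k} → (∀ {e} → IsLiveEnd T c e → IsLiveEnd T r e) →
    KillsOneEnd c c′ → LostEnds r c k → LostEnds r c′ (suc k)
  lost-ends-after-escape {r} {c} {c′} {k} initially kill lost = record
    { ends = ends′ ; live-before = live-before′ ; dead-now = dead-now′ ; distinct = distinct′ }
    where
    open KillsOneEnd kill
    open LostEnds lost
    ends′ : Fin (suc k) → ℕ → ℕ
    ends′ Fin.zero    = killed
    ends′ (Fin.suc a) = ends a
    live-before′ : ∀ a → IsLiveEnd T r (ends′ a)
    live-before′ Fin.zero    = initially killed-live
    live-before′ (Fin.suc a) = live-before a
    dead-now′ : ∀ a → ¬ IsLiveEnd T c′ (ends′ a)
    dead-now′ Fin.zero    = killed-dead
    dead-now′ (Fin.suc a) = dead-now a ∘ live-after-escape kill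
    distinct′ : Distinct ends′
    distinct′ Fin.zero    Fin.zero     ne   = contradiction refl ne
    distinct′ Fin.zero    (Fin.suc a)  _ same = dead-now a (live-SameEnd {c} same killed-live)
    distinct′ (Fin.suc a) Fin.zero     _ same = dead-now a (live-SameEnd {c} (sym ∘ same) killed-live)
    distinct′ (Fin.suc a) (Fin.suc a′) ne   = distinct a a′ (ne ∘ cong Fin.suc)

  return-keeps-live-ends : ∀ {c c′ m} → ReturnsWith T c c′ → AtLeastLiveEnds T c m → AtLeastLiveEnds T c′ m
  return-keeps-live-ends rw (f , live , distinct) =
    f , (λ a → live-transfer (returned-agree rw (f a)) (live a)) , distinct

  escape-keeps-all-but-one : ExcludedMiddle 0ℓ → ∀ {c c′ m} → KillsOneEnd c c′ → AtLeastLiveEnds T c m →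
    Σ ℕ λ m′ → m ≤ suc m′ × AtLeastLiveEnds T c′ m′
  escape-keeps-all-but-one em {m = m} kill (f , live , distinct)
    with em {Σ (Fin m) λ a → SameEnd (f a) (KillsOneEnd.killed kill)}
  ... | no none = m , n≤1+n m , f , (λ a → live-before-escape kill (λ same → none (a , same)) (live a)) , distinct
  escape-keeps-all-but-one em {m = suc m} kill (f , live , distinct) | yes (a , same) =
    m , ≤-refl , f ∘ punchIn a , (λ a′ → live-before-escape kill (not-killed a′) (live (punchIn a a′))) ,
    λ a′ a″ ne → distinct (punchIn a a′) (punchIn a a″) (ne ∘ punchIn-injective a a′ a″)
    where
    not-killed : ∀ a′ → ¬ SameEnd (f (punchIn a a′)) (KillsOneEnd.killed kill)
    not-killed a′ same′ = distinct (punchIn a a′) a (punchInᵢ≢i a a′) λ i → trans (same′ i) (sym (same i))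

  -- An escaping particle

  module Escaping (em : ExcludedMiddle 0ℓ) {c : Config} (rc : IsRotorConfig T c) (escapes : Escapes T c) where
    open Walk T c

    EventuallyIn : Vertex → Set
    EventuallyIn x = Σ ℕ λ t₀ → ∀ {u} → t₀ ≤ u → InSubtree x (P u)

    in-tree : ∀ {u} → 1 ≤ u → InSubtree [] (P u)
    in-tree {u} 1≤u with P u in at
    ... | nothing = contradiction at (escapes u 1≤u)
    ... | just w  = []≼ w

    -- To re-enter the subtree of j ∷ y the particle must step down from y, whose rotor
    -- would have to come round to j again, i.e. wrap.
    no-reentry-after-wrap : ∀ x {u} → P u ≡ just x → C (suc u) x ≡ 0 →
      ∀ {u′} → suc u ≤ u′ → ¬ InSubtree x (P u′)
    no-reentry-after-wrap [] {u} at wraps _ _ =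
      escapes (suc u) (s≤s z≤n) (trans (P-suc-here u at) (cong (nbr []) wraps))
    no-reentry-after-wrap (j ∷ y) {u} at wraps su≤u′ inside
      with last-entry (j ∷ y) su≤u′
             (λ inside′ → ∷⋠ (subst (InSubtree (j ∷ y)) (trans (P-suc-here u at) (cong (nbr (j ∷ y)) wraps))
                                    inside′))
             inside
    ... | u₁ , su≤u₁ , _ , at-y , down with rotor-wraps-or-grows y su≤u₁
    ...   | inj₁ (u₂ , _ , u₂<u₁ , at₂ , wraps₂) =
      no-reentry-after-wrap y at₂ wraps₂ u₂<u₁ (≡just⇒InSubtree at-y)
    ...   | inj₂ grows with advance-cases T y (C u₁ y)
    ...     | inj₁ wraps₁ = parent≢child y
              (trans (sym (trans (P-suc-here u₁ at-y) (cong (nbr y) (trans (C-suc-here u₁ at-y) wraps₁)))) down)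
    ...     | inj₂ steps = 1+n≰n (subst (_≤ C u₁ y) (trans pointed-at-j (sym stepped-to-j)) grows)
      where
      pointed-at-j : C (suc u) y ≡ j
      pointed-at-j = trans (rotor-kept-above u at here) (rotor-towards u at here)
      stepped-to-j : suc (C u₁ y) ≡ j
      stepped-to-j = trans (sym (trans (C-suc-here u₁ at-y) steps))
                           (nbr-child⇒≡ y _ (trans (sym (P-suc-here u₁ at-y)) down))

    record SettlesBelow (x : Vertex) : Set where
      field
        k               : ℕ
        k-child         : 1 ≤ k × k ≤ b T x
        k-above-initial : c x < k
        k-final         : Σ ℕ λ t₁ → ∀ {u} → t₁ ≤ u → C u x ≡ k
        trap            : EventuallyIn (k ∷ x)

    module Settle {x} (ev : EventuallyIn x) where

      never-wraps : ∀ u → P u ≡ just x → C (suc u) x ≢ 0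
      never-wraps u at wraps =
        no-reentry-after-wrap x at wraps (m≤m+n (suc u) (proj₁ ev)) (proj₂ ev (m≤n+m (proj₁ ev) (suc u)))

      rotor-monotone : ∀ {a b} → a ≤ b → C a x ≤ C b x
      rotor-monotone a≤b with rotor-wraps-or-grows x a≤b
      ... | inj₁ (u , _ , _ , at , wraps) = contradiction wraps (never-wraps u at)
      ... | inj₂ grows = grows

      abstract
        settling : Σ ℕ λ t₁ → proj₁ ev ≤ t₁ × (∀ {u} → t₁ ≤ u → C u x ≡ C t₁ x)
        settling = monotone-bounded-stabilises em (λ u → C u x) rotor-monotone
          (λ u → valid-rotors rc u x x-valid) (proj₁ ev)
          where
          x-valid : Valid T x
          x-valid = InSubtree-valid (P (proj₁ ev)) (valid-position rc (proj₁ ev)) (proj₂ ev ≤-refl)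

      t₁ : ℕ
      t₁ = proj₁ settling

      settled : ∀ {u} → t₁ ≤ u → C u x ≡ C t₁ x
      settled = proj₂ (proj₂ settling)

      absent : ∀ {u} → t₁ ≤ u → P u ≢ just x
      absent {u} t₁≤u at = never-wraps u at (trans (C-suc-here u at) (advance-fixed⇒≡0 T x fixed))
        where
        fixed : advance T x (C u x) ≡ C u x
        fixed = trans (sym (C-suc-here u at)) (trans (settled (m≤n⇒m≤1+n t₁≤u)) (sym (settled t₁≤u)))

      child : Σ ℕ λ k → InSubtree (k ∷ x) (P t₁)
      child = InSubtree-strict (P t₁) (proj₂ ev (proj₁ (proj₂ settling))) (absent ≤-refl)

      k : ℕ
      k = proj₁ child

      trap : EventuallyIn (k ∷ x)
      trap = t₁ , induction-from {Q = λ u → InSubtree (k ∷ x) (P u)} (proj₂ child) stay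
        where
        stay : ∀ {u} → t₁ ≤ u → InSubtree (k ∷ x) (P u) → InSubtree (k ∷ x) (P (suc u))
        stay {u} t₁≤u in-u with InSubtree? (k ∷ x) (P (suc u))
        ... | yes in′ = in′
        ... | no out  = contradiction (proj₂ (leaves u in-u out)) (absent (m≤n⇒m≤1+n t₁≤u))

      k-final : Σ ℕ λ t → ∀ {u} → t ≤ u → C u x ≡ k
      k-final = t₁ , λ t₁≤u → trans (settled t₁≤u) (ancestor-rotor t₁ (proj₂ child))

      k-child : 1 ≤ k × k ≤ b T x
      k-child = proj₂ (InSubtree-valid (P t₁) (valid-position rc t₁) (proj₂ child))

      k-above-initial : c x < k
      k-above-initial with last-entry (k ∷ x) {b = t₁} z≤n (λ ()) (proj₂ child)
      ... | u , _ , _ , at , down with advance-cases T x (C u x)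
      ...   | inj₁ wraps = contradiction (trans (C-suc-here u at) wraps) (never-wraps u at)
      ...   | inj₂ steps = subst (c x <_) stepped-to-k (s≤s (rotor-monotone {b = u} z≤n))
        where
        stepped-to-k : suc (C u x) ≡ k
        stepped-to-k = trans (sym (trans (C-suc-here u at) steps))
                             (nbr-child⇒≡ x _ (trans (sym (P-suc-here u at)) down))

    abstract
      settles : ∀ {x} → EventuallyIn x → SettlesBelow x
      settles ev = record
        { k = k ; k-child = k-child ; k-above-initial = k-above-initial ; k-final = k-final ; trap = trap }
        where open Settle ev

    chain : ℕ → Σ Vertex EventuallyIn
    chain zero    = [] , 1 , in-tree
    chain (suc i) = SettlesBelow.k settled ∷ proj₁ (chain i) , SettlesBelow.trap settled
      where settled = settles (proj₂ (chain i))

    escape-end : ℕ → ℕ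
    escape-end i = SettlesBelow.k (settles (proj₂ (chain i)))

    prefix-escape-end : ∀ i → prefix escape-end i ≡ proj₁ (chain i)
    prefix-escape-end zero    = refl
    prefix-escape-end (suc i) = cong (escape-end i ∷_) (prefix-escape-end i)

    along : ∀ {ℓ} (Φ : Vertex → ℕ → Set ℓ) →
      (∀ {x} (ev : EventuallyIn x) → Φ x (SettlesBelow.k (settles ev))) →
      ∀ i → Φ (prefix escape-end i) (escape-end i)
    along Φ fact i = subst (λ x → Φ x (escape-end i)) (sym (prefix-escape-end i)) (fact (proj₂ (chain i)))

    trapped-along : ∀ i → EventuallyIn (prefix escape-end i)
    trapped-along i = subst EventuallyIn (sym (prefix-escape-end i)) (proj₂ (chain i))

    escape-end-live : IsLiveEnd T c escape-end
    escape-end-live = along (λ x k → 1 ≤ k × k ≤ b T x) (SettlesBelow.k-child ∘ settles) , 0 ,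
                      λ i _ → along (λ x k → c x < k) (SettlesBelow.k-above-initial ∘ settles) i

    escape-end-final : ∀ i → Σ ℕ λ t₁ → ∀ {u} → t₁ ≤ u → C u (prefix escape-end i) ≡ escape-end i
    escape-end-final = along (λ x k → Σ ℕ λ t₁ → ∀ {u} → t₁ ≤ u → C u x ≡ k) (SettlesBelow.k-final ∘ settles)

    eventually-absent : ∀ v → Σ ℕ λ t₀ → ∀ {u} → t₀ ≤ u → P u ≢ just v
    eventually-absent v with trapped-along (suc (length v))
    ... | t₀ , inside = t₀ , λ t₀≤u at → 1+n≰n (subst (_≤ length v) (length-prefix escape-end (suc (length v)))
                                                      (≼-length (subst (InSubtree _) at (inside t₀≤u))))

    avoids-diverging-end : ∀ {e j} → e j ≢ escape-end j →
      Σ ℕ λ M → ∀ {i} → M ≤ i → ∀ u → P u ≢ just (prefix e i)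
    avoids-diverging-end {e} {j} diverge with trapped-along (suc j)
    ... | t₀ , inside = t₀ , avoid
      where
      avoid : ∀ {i} → t₀ ≤ i → ∀ u → P u ≢ just (prefix e i)
      avoid {i} t₀≤i u at with u <? t₀
      ... | yes u<t₀ =
        n≮n i (<-≤-trans (subst (_< u) (length-prefix e i) (depth-< u at)) (≤-trans (<⇒≤ u<t₀) t₀≤i))
      ... | no ¬u<t₀ =
        diverge (sym (≼-prefix-head e escape-end (subst (InSubtree _) at (inside (≮⇒≥ ¬u<t₀)))))

    limit-config : Σ Config (LimitConfig T c)
    limit-config = (λ v → C (proj₁ (eventually-absent v)) v) , λ v →
      proj₁ (eventually-absent v) , λ t t₀≤t → rotor-unchanged v t₀≤t λ t₀≤u _ → proj₂ (eventually-absent v) t₀≤u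

    module _ {c′} (lim : LimitConfig T c c′) where

      escape-end-dead : ¬ IsLiveEnd T c′ escape-end
      escape-end-dead (_ , m , live) with lim (prefix escape-end m) | escape-end-final m
      ... | t₀ , limit | t₁ , final =
        <-irrefl (trans (sym (limit (t₀ + t₁) (m≤m+n t₀ t₁))) (final (m≤n+m t₁ t₀))) (live m ≤-refl)

      others-agree : ∀ e → ¬ SameEnd e escape-end → EventuallyAgree c c′ e
      others-agree e ¬same with divergence em ¬same
      ... | j , diverge with avoids-diverging-end diverge
      ...   | M , never = agree-beyond M λ i M≤i →
        trans (sym (rotor-unchanged (prefix e i) {0} {proj₁ (lim (prefix e i))} z≤n λ {u} _ _ → never M≤i u))
              (proj₂ (lim (prefix e i)) _ ≤-refl)

      escape-kills-one-end : KillsOneEnd c c′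
      escape-kills-one-end = record
        { killed       = escape-end
        ; killed-live  = escape-end-live
        ; killed-dead  = escape-end-dead
        ; others-agree = others-agree
        }

  -- The whole process

  Outcome : Config → Config → Bool → Set
  Outcome c c′ escaped =
    ((escaped ≡ false) × ReturnsWith T c c′) ⊎ ((escaped ≡ true) × Escapes T c × LimitConfig T c c′)

  outcome-valid : ∀ {c c′ escaped} → IsRotorConfig T c → Outcome c c′ escaped → IsRotorConfig T c′
  outcome-valid {c} rc (inj₁ (_ , t , _ , _ , _ , final)) v valid =
    subst (_≤ b T v) (final v) (Walk.valid-rotors T c rc t v valid)
  outcome-valid {c} rc (inj₂ (_ , _ , lim)) v valid =
    subst (_≤ b T v) (proj₂ (lim v) (proj₁ (lim v)) ≤-refl) (Walk.valid-rotors T c rc (proj₁ (lim v)) v valid)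

  module Construction (em : ExcludedMiddle 0ℓ) where

    module _ {c : Config} where
      open Walk T c

      first-return : ¬ Escapes T c → Σ Config (ReturnsWith T c)
      first-return ¬escapes with em {Σ ℕ λ t → 1 ≤ t × P t ≡ nothing}
      ... | no never = contradiction (λ t 1≤t returned → never (t , 1≤t , returned)) ¬escapes
      ... | yes (t , returns) with least-witness (λ t → 1 ≤? t ×-dec (P t ≟ₚ nothing)) returns
      ...   | t₀ , _ , (1≤t₀ , returned) , before =
        C t₀ , t₀ , 1≤t₀ , returned , (λ s 1≤s s<t₀ at → before s<t₀ (1≤s , at)) , λ _ → refl

    run-particle : ∀ {c} → IsRotorConfig T c → Σ Config λ c′ → Σ Bool (Outcome c c′)
    run-particle {c} rc with em {Escapes T c}
    ... | yes escapes = proj₁ limit , true , inj₂ (refl , escapes , proj₂ limit)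
      where limit = Escaping.limit-config em rc escapes
    ... | no ¬escapes = proj₁ (first-return ¬escapes) , false , inj₁ (refl , proj₂ (first-return ¬escapes))

    process-exists : ∀ {r} → IsRotorConfig T r →
      Σ (ℕ → Config) λ cs → Σ (ℕ → Bool) λ esc → Process T r cs esc
    process-exists {r} rc = proj₁ ∘ states , escaped , (λ _ → refl) , outcome
      where
      states : ℕ → Σ Config (IsRotorConfig T)
      next : ∀ q → Σ Config λ c′ → Σ Bool (Outcome (proj₁ (states q)) c′)
      states zero    = r , rc
      states (suc q) = proj₁ (next q) , outcome-valid (proj₂ (states q)) (proj₂ (proj₂ (next q)))
      next q = run-particle (proj₂ (states q))
      escaped : ℕ → Bool
      escaped q = proj₁ (proj₂ (next q))
      outcome : ∀ q → Outcome (proj₁ (states q)) (proj₁ (states (suc q))) (escaped q)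
      outcome q = proj₂ (proj₂ (next q))

  module Counting (em : ExcludedMiddle 0ℓ) {r} (rc : IsRotorConfig T r)
                  {cs : ℕ → Config} {esc : ℕ → Bool} (proc : Process T r cs esc) where

    valid : ∀ q → IsRotorConfig T (cs q)
    valid zero v vv = subst (_≤ b T v) (sym (proj₁ proc v)) (rc v vv)
    valid (suc q)   = outcome-valid (valid q) (proj₂ proc q)

    kills : ∀ {q} → Escapes T (cs q) → LimitConfig T (cs q) (cs (suc q)) → KillsOneEnd (cs q) (cs (suc q))
    kills {q} escapes = Escaping.escape-kills-one-end em (valid q) escapes

    live-initially : ∀ q {e} → IsLiveEnd T (cs q) e → IsLiveEnd T r e
    live-initially zero = live-transfer (agree-everywhere (proj₁ proc))
    live-initially (suc q) live with proj₂ proc q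
    ... | inj₁ (_ , rw) = live-initially q (live-transfer (EventuallyAgree-sym (returned-agree rw _)) live)
    ... | inj₂ (_ , escapes , lim) = live-initially q (live-after-escape (kills escapes lim) live)

    lost-ends : ∀ n → LostEnds r (cs n) (count esc n)
    lost-ends zero = record { ends = λ () ; live-before = λ () ; dead-now = λ () ; distinct = λ () }
    lost-ends (suc n) with esc n | proj₂ proc n | lost-ends n
    ... | false | inj₂ (() , _) | _
    ... | true  | inj₁ (() , _) | _
    ... | false | inj₁ (_ , rw) | lost = lost-ends-after-return rw lost
    ... | true  | inj₂ (_ , escapes , lim) | lost = lost-ends-after-escape (live-initially n) (kills escapes lim) lost

    escapes⇒live-ends : ∀ {k} → AtLeastEscapes esc k → AtLeastLiveEnds T r k
    escapes⇒live-ends (n , k≤) = ends ∘ embed , live-before ∘ embed ,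
      λ a a′ ne → distinct (embed a) (embed a′) (ne ∘ inject≤-injective k≤ k≤ a a′)
      where
      open LostEnds (lost-ends n)
      embed : Fin _ → Fin (count esc n)
      embed a = inject≤ a k≤

    surviving-ends : ∀ {k} → AtLeastLiveEnds T r k →
      ∀ n → Σ ℕ λ m → k ≤ m + count esc n × AtLeastLiveEnds T (cs n) m
    surviving-ends {k} (f , live , distinct) zero =
      k , m≤m+n k 0 , f , (λ a → live-transfer (agree-everywhere (λ v → sym (proj₁ proc v))) (live a)) , distinct
    surviving-ends ends (suc n) with esc n | proj₂ proc n | surviving-ends ends n
    ... | false | inj₂ (() , _) | _
    ... | true  | inj₁ (() , _) | _
    ... | false | inj₁ (_ , rw) | m , k≤ , live = m , k≤ , return-keeps-live-ends rw live
    ... | true  | inj₂ (_ , escapes , lim) | m , k≤ , live with escape-keeps-all-but-one em (kills escapes lim) live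
    ...   | m′ , m≤ , live′ =
      m′ , ≤-trans k≤ (≤-trans (+-monoˡ-≤ _ m≤) (≤-reflexive (sym (+-suc m′ _)))) , live′

    escape-ahead : ∀ n {e} → IsLiveEnd T (cs n) e → Σ ℕ λ q → n ≤ q × esc q ≡ true
    escape-ahead n live with em {Σ ℕ λ q → n ≤ q × esc q ≡ true}
    ... | yes found = found
    ... | no  none  = contradiction live (AllReturn.no-live-end {λ j → cs (j + n)} returns)
      where
      returns : ∀ j → ReturnsWith T (cs (j + n)) (cs (suc j + n))
      returns j with proj₂ proc (j + n)
      ... | inj₁ (_ , rw)       = rw
      ... | inj₂ (escaped , _) = contradiction (j + n , m≤n+m n j , escaped) none

    live-ends⇒escapes : ∀ {k} → AtLeastLiveEnds T r k → AtLeastEscapes esc k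
    live-ends⇒escapes {k} ends = reach k ≤-refl
      where
      reach : ∀ j → j ≤ k → AtLeastEscapes esc j
      reach zero _ = 0 , z≤n
      reach (suc j) j<k with reach j (<⇒≤ j<k)
      ... | n , j≤ with suc j ≤? count esc n
      ...   | yes done = n , done
      ...   | no ¬done with surviving-ends ends n
      ...     | zero  , k≤ , _ = contradiction (≤-trans j<k k≤) ¬done
      ...     | suc m , _ , _ , live , _ with escape-ahead n (live Fin.zero)
      ...       | q , n≤q , escaped =
        suc q , subst (suc j ≤_) (sym (count-true esc escaped)) (s≤s (≤-trans j≤ (count-mono esc n≤q)))

-- The argument does not use that T is infinite.
proposition8 : ExcludedMiddle 0ℓ →
    (T : Tree) → Infinite T → (r : Config) → IsRotorConfig T r →
      (Σ (ℕ → Config) λ cs → Σ (ℕ → Bool) λ esc → Process T r cs esc)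
    × ((cs : ℕ → Config) (esc : ℕ → Bool) → Process T r cs esc →
        (k : ℕ) → AtLeastEscapes esc k ⇔ AtLeastLiveEnds T r k)
proposition8 em T _ r rc =
  Construction.process-exists T em rc ,
  λ cs esc proc k → mk⇔ (Counting.escapes⇒live-ends T em rc proc) (Counting.live-ends⇒escapes T em rc proc)
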